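{- Let $S$ and $T$ be balanced bitstrings. If the unit of area $(x,y)$ is between $w(S)$ and $w(T)$, then $(x-y-1,\,2y-x+1)$ is between $S$ and $T$.
   Context: Two bitstrings are balanced if they have the same length and the same number of ones. $w$ is the map on bitstrings that simultaneously replaces each $0$ by $001$ and each $1$ by $01$. A unit of area is a pair $(x,y)\in\mathbb{Z}^2$. $(x,y)$ is below a string $S$ if some prefix of $S$ (possibly empty) has at most $x$ zeros and at least $y+1$ ones; $(x,y)$ is above $S$ if some prefix of $S$ has at most $y$ ones and at least $x+1$ zeros. For balanced $S,T$, $(x,y)$ is between $S$ and $T$ if it is above one of them and below the other. -}

module Defs where

open import Data.Bool using (Bool; true; false)
open import Data.List using (List; []; _∷_; _++_; take; length; filter; concatMap)
open import Data.Nat using (ℕ; zero; suc) renaming (_≤_ to _≤ℕ_)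
open import Data.Integer using (ℤ; +_; _+_; _≤_; 1ℤ)
open import Data.Product using (Σ; _×_; ∃-syntax)
open import Data.Sum using (_⊎_)
open import Relation.Binary.PropositionalEquality using (_≡_)

-- Bitstrings: false = 0, true = 1.
Bitstring : Set
Bitstring = List Bool

zeros : Bitstring → ℕ
zeros [] = zero
zeros (false ∷ s) = suc (zeros s)
zeros (true ∷ s) = zeros s

ones : Bitstring → ℕ
ones [] = zero
ones (false ∷ s) = ones s
ones (true ∷ s) = suc (ones s)

Balanced : Bitstring → Bitstring → Set
Balanced S T = (length S ≡ length T) × (ones S ≡ ones T)

wLetter : Bool → Bitstring
wLetter false = false ∷ false ∷ true ∷ []
wLetter true = false ∷ true ∷ []

w : Bitstring → Bitstring
w [] = []
w (b ∷ s) = wLetter b ++ w s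

Below : ℤ × ℤ → Bitstring → Set
Below (x Data.Product., y) S =
  ∃[ k ] (k ≤ℕ length S × (+ zeros (take k S) ≤ x) × (y + 1ℤ ≤ + ones (take k S)))

Above : ℤ × ℤ → Bitstring → Set
Above (x Data.Product., y) S =
  ∃[ k ] (k ≤ℕ length S × (+ ones (take k S) ≤ y) × (x + 1ℤ ≤ + zeros (take k S)))

Between : ℤ × ℤ → Bitstring → Bitstring → Set
Between p S T = (Above p S × Below p T) ⊎ (Below p S × Above p T)

-- A point is above/below a string iff some prefix, i.e. some count vector
-- (#zeros, #ones) reached along the string, lies in a fixed quadrant relative
-- to the point.  Reading w S letter by letter, a letter b of S adds the count
-- vector of w b, namely (2,1) or (1,1), and φ (x , y) = (x - y - 1 , 2y - x + 1)
-- turns a translation by that vector into a translation by the count vector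
-- (1,0) or (0,1) of b itself.  So one may translate the point along the
-- letters and induct; the only arithmetic left is the few prefixes of a
-- single w b, where the quadrant condition for the point transfers to one for
-- its image under φ.
module Submission where

open import Defs
open import Data.Bool using (true; false; T)
open import Data.Integer using (ℤ; _+_; _-_; _*_; -_; 1ℤ; +_; _≤_; +≤+)
open import Data.Integer.Properties using (+-mono-≤; +-monoˡ-≤; +-monoʳ-≤; neg-mono-≤; module ≤-Reasoning)
open import Data.Integer.Tactic.RingSolver using (solve; solve-∀)
open import Data.List using (List; []; _∷_; _++_; take; length)
open import Data.Nat using (zero; suc; z≤n; s≤s; _≤ᵇ_) renaming (_+_ to _+ℕ_; _≤_ to _≤ℕ_)
open import Data.Nat.Properties using (≤ᵇ⇒≤)
open import Data.Product using (_×_; _,_; ∃-syntax)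
open import Data.Sum using (_⊎_; inj₁; inj₂)
open import Function using (_∘_)
open import Relation.Binary.PropositionalEquality using (_≡_; refl; cong; cong₂; subst)

private
  variable
    A : Set

HasPrefix : (List A → Set) → List A → Set
HasPrefix P xs = ∃[ k ] (k ≤ℕ length xs × P (take k xs))

hasPrefix-map : {P Q : List A → Set} → (∀ u → P u → Q u) → ∀ {xs} → HasPrefix P xs → HasPrefix Q xs
hasPrefix-map f (k , k≤ , p) = k , k≤ , f _ p

hasPrefix-++⁺ʳ : {P : List A → Set} (xs : List A) {ys : List A} →
                 HasPrefix (P ∘ (xs ++_)) ys → HasPrefix P (xs ++ ys)
hasPrefix-++⁺ʳ          []       h = h
hasPrefix-++⁺ʳ {P = P} (x ∷ xs) h with hasPrefix-++⁺ʳ {P = P ∘ (x ∷_)} xs h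
... | k , k≤ , p = suc k , s≤s k≤ , p

hasPrefix-++⁻ : {P : List A → Set} (xs : List A) {ys : List A} →
                HasPrefix P (xs ++ ys) → HasPrefix P xs ⊎ HasPrefix (P ∘ (xs ++_)) ys
hasPrefix-++⁻          []       h                     = inj₂ h
hasPrefix-++⁻          (x ∷ xs) (zero , _ , p)        = inj₁ (zero , z≤n , p)
hasPrefix-++⁻ {P = P} (x ∷ xs) (suc k , s≤s k≤ , p)
  with hasPrefix-++⁻ {P = P ∘ (x ∷_)} xs (k , k≤ , p)
... | inj₁ (j , j≤ , q) = inj₁ (suc j , s≤s j≤ , q)
... | inj₂ h            = inj₂ h

zeros-++ : ∀ u v → zeros (u ++ v) ≡ zeros u +ℕ zeros v
zeros-++ []          v = refl
zeros-++ (false ∷ u) v = cong suc (zeros-++ u v)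
zeros-++ (true ∷ u)  v = zeros-++ u v

ones-++ : ∀ u v → ones (u ++ v) ≡ ones u +ℕ ones v
ones-++ []          v = refl
ones-++ (false ∷ u) v = ones-++ u v
ones-++ (true ∷ u)  v = cong suc (ones-++ u v)

module _ (i k : ℤ) {j : ℤ} where
  open ≤-Reasoning

  i+j≤k⇒j≤k-i : i + j ≤ k → j ≤ k - i
  i+j≤k⇒j≤k-i h = begin
    j           ≡⟨ solve (i ∷ j ∷ []) ⟩
    (i + j) - i ≤⟨ +-monoˡ-≤ (- i) h ⟩
    k - i       ∎

  j≤k-i⇒i+j≤k : j ≤ k - i → i + j ≤ k
  j≤k-i⇒i+j≤k h = begin
    i + j       ≤⟨ +-monoʳ-≤ i h ⟩
    i + (k - i) ≡⟨ solve (i ∷ k ∷ []) ⟩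
    k           ∎

  k+1≤i+j⇒k-i+1≤j : k + 1ℤ ≤ i + j → k - i + 1ℤ ≤ j
  k+1≤i+j⇒k-i+1≤j h = begin
    k - i + 1ℤ        ≡⟨ solve (i ∷ k ∷ []) ⟩
    (k + 1ℤ) - i      ≤⟨ +-monoˡ-≤ (- i) h ⟩
    (i + j) - i       ≡⟨ solve (i ∷ j ∷ []) ⟩
    j                 ∎

  k-i+1≤j⇒k+1≤i+j : k - i + 1ℤ ≤ j → k + 1ℤ ≤ i + j
  k-i+1≤j⇒k+1≤i+j h = begin
    k + 1ℤ            ≡⟨ solve (i ∷ k ∷ []) ⟩
    i + (k - i + 1ℤ)  ≤⟨ +-monoʳ-≤ i h ⟩
    i + j             ∎

Point : Set
Point = ℤ × ℤ

AboveAt : Point → Bitstring → Set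
AboveAt (x , y) u = (+ ones u ≤ y) × (x + 1ℤ ≤ + zeros u)

BelowAt : Point → Bitstring → Set
BelowAt (x , y) u = (+ zeros u ≤ x) × (y + 1ℤ ≤ + ones u)

shift : Bitstring → Point → Point
shift u (x , y) = (x - + zeros u , y - + ones u)

aboveAt-++⁻ : ∀ p u v → AboveAt p (u ++ v) → AboveAt (shift u p) v
aboveAt-++⁻ (x , y) u v (o≤y , x<z) rewrite ones-++ u v | zeros-++ u v =
  i+j≤k⇒j≤k-i (+ ones u) y o≤y , k+1≤i+j⇒k-i+1≤j (+ zeros u) x x<z

aboveAt-++⁺ : ∀ p u v → AboveAt (shift u p) v → AboveAt p (u ++ v)
aboveAt-++⁺ (x , y) u v (o≤y , x<z) rewrite ones-++ u v | zeros-++ u v =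
  j≤k-i⇒i+j≤k (+ ones u) y o≤y , k-i+1≤j⇒k+1≤i+j (+ zeros u) x x<z

belowAt-++⁻ : ∀ p u v → BelowAt p (u ++ v) → BelowAt (shift u p) v
belowAt-++⁻ (x , y) u v (z≤x , y<o) rewrite ones-++ u v | zeros-++ u v =
  i+j≤k⇒j≤k-i (+ zeros u) x z≤x , k+1≤i+j⇒k-i+1≤j (+ ones u) y y<o

belowAt-++⁺ : ∀ p u v → BelowAt (shift u p) v → BelowAt p (u ++ v)
belowAt-++⁺ (x , y) u v (z≤x , y<o) rewrite ones-++ u v | zeros-++ u v =
  j≤k-i⇒i+j≤k (+ zeros u) x z≤x , k-i+1≤j⇒k+1≤i+j (+ ones u) y y<o

φ : Point → Point
φ (x , y) = (x - y - 1ℤ , + 2 * y - x + 1ℤ)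

φ-shift : ∀ x y a b → φ (x - a , y - b) ≡ (x - y - 1ℤ - (a - b) , + 2 * y - x + 1ℤ - (+ 2 * b - a))
φ-shift x y a b = cong₂ _,_ (first x y a b) (second x y a b)
  where
  first : ∀ x y a b → x - a - (y - b) - 1ℤ ≡ x - y - 1ℤ - (a - b)
  first = solve-∀
  second : ∀ x y a b → + 2 * (y - b) - (x - a) + 1ℤ ≡ + 2 * y - x + 1ℤ - (+ 2 * b - a)
  second = solve-∀

φ-shift-wLetter : ∀ b p → φ (shift (wLetter b) p) ≡ shift (b ∷ []) (φ p)
φ-shift-wLetter false (x , y) = φ-shift x y (+ 2) (+ 1)
φ-shift-wLetter true  (x , y) = φ-shift x y (+ 1) (+ 1)

aboveAt-φ : ∀ {p} u v → zeros u ≤ℕ zeros v +ℕ ones u +ℕ 1 → ones v +ℕ zeros u ≤ℕ ones u +ℕ ones u +ℕ 2 →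
            AboveAt p u → AboveAt (φ p) v
aboveAt-φ u v c₁ c₂ (o≤y , x<z) = bounds o≤y x<z (+≤+ c₂) (+≤+ c₁)
  where
  open ≤-Reasoning
  bounds : ∀ {x y o z o′ z′} → o ≤ y → x + 1ℤ ≤ z → o′ + z ≤ o + o + + 2 → z ≤ z′ + o + 1ℤ →
           (o′ ≤ + 2 * y - x + 1ℤ) × (x - y - 1ℤ + 1ℤ ≤ z′)
  bounds {x} {y} {o} {z} {o′} {z′} o≤y x<z c₂ c₁ =
    (begin
      o′                         ≡⟨ solve (z ∷ o′ ∷ []) ⟩
      (o′ + z) - z               ≤⟨ +-mono-≤ c₂ (neg-mono-≤ x<z) ⟩
      (o + o + + 2) - (x + 1ℤ)   ≤⟨ +-monoˡ-≤ _ (+-monoˡ-≤ _ (+-mono-≤ o≤y o≤y)) ⟩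
      (y + y + + 2) - (x + 1ℤ)   ≡⟨ solve (x ∷ y ∷ []) ⟩
      + 2 * y - x + 1ℤ           ∎) ,
    (begin
      x - y - 1ℤ + 1ℤ            ≡⟨ solve (x ∷ y ∷ []) ⟩
      (x + 1ℤ) - y - 1ℤ          ≤⟨ +-monoˡ-≤ _ (+-mono-≤ x<z (neg-mono-≤ o≤y)) ⟩
      z - o - 1ℤ                 ≤⟨ +-monoˡ-≤ _ (+-monoˡ-≤ _ c₁) ⟩
      (z′ + o + 1ℤ) - o - 1ℤ     ≡⟨ solve (o ∷ z′ ∷ []) ⟩
      z′                         ∎)

belowAt-φ : ∀ {p} u v → zeros v +ℕ ones u ≤ℕ zeros u → ones u +ℕ ones u ≤ℕ ones v +ℕ zeros u →
            BelowAt p u → BelowAt (φ p) v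
belowAt-φ u v c₁ c₂ (z≤x , y<o) = bounds z≤x y<o (+≤+ c₁) (+≤+ c₂)
  where
  open ≤-Reasoning
  bounds : ∀ {x y o z o′ z′} → z ≤ x → y + 1ℤ ≤ o → z′ + o ≤ z → o + o ≤ o′ + z →
           (z′ ≤ x - y - 1ℤ) × (+ 2 * y - x + 1ℤ + 1ℤ ≤ o′)
  bounds {x} {y} {o} {z} {o′} {z′} z≤x y<o c₁ c₂ =
    (begin
      z′                         ≡⟨ solve (o ∷ z′ ∷ []) ⟩
      (z′ + o) - o               ≤⟨ +-mono-≤ c₁ (neg-mono-≤ y<o) ⟩
      z - (y + 1ℤ)               ≤⟨ +-monoˡ-≤ _ z≤x ⟩
      x - (y + 1ℤ)               ≡⟨ solve (x ∷ y ∷ []) ⟩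
      x - y - 1ℤ                 ∎) ,
    (begin
      + 2 * y - x + 1ℤ + 1ℤ      ≡⟨ solve (x ∷ y ∷ []) ⟩
      (y + 1ℤ) + (y + 1ℤ) - x    ≤⟨ +-mono-≤ (+-mono-≤ y<o y<o) (neg-mono-≤ z≤x) ⟩
      o + o - z                  ≤⟨ +-monoˡ-≤ _ c₂ ⟩
      (o′ + z) - z               ≡⟨ solve (z ∷ o′ ∷ []) ⟩
      o′                         ∎)

private
  ≤-by-computation : ∀ {m n} {_ : T (m ≤ᵇ n)} → m ≤ℕ n
  ≤-by-computation {m} {n} {m≤ᵇn} = ≤ᵇ⇒≤ m n m≤ᵇn

aboveAt-φ-wLetter : ∀ {p} b s → HasPrefix (AboveAt p) (wLetter b) → HasPrefix (AboveAt (φ p)) (b ∷ s)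
aboveAt-φ-wLetter false s (0 , _ , a) =
  0 , z≤n , aboveAt-φ [] [] ≤-by-computation ≤-by-computation a
aboveAt-φ-wLetter false s (1 , _ , a) =
  0 , z≤n , aboveAt-φ (false ∷ []) [] ≤-by-computation ≤-by-computation a
aboveAt-φ-wLetter false s (2 , _ , a) =
  1 , s≤s z≤n , aboveAt-φ (false ∷ false ∷ []) (false ∷ []) ≤-by-computation ≤-by-computation a
aboveAt-φ-wLetter false s (3 , _ , a) =
  0 , z≤n , aboveAt-φ (false ∷ false ∷ true ∷ []) [] ≤-by-computation ≤-by-computation a
aboveAt-φ-wLetter false s (suc (suc (suc (suc _))) , s≤s (s≤s (s≤s ())) , _)
aboveAt-φ-wLetter true  s (0 , _ , a) =
  0 , z≤n , aboveAt-φ [] [] ≤-by-computation ≤-by-computation a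
aboveAt-φ-wLetter true  s (1 , _ , a) =
  0 , z≤n , aboveAt-φ (false ∷ []) [] ≤-by-computation ≤-by-computation a
aboveAt-φ-wLetter true  s (2 , _ , a) =
  0 , z≤n , aboveAt-φ (false ∷ true ∷ []) [] ≤-by-computation ≤-by-computation a
aboveAt-φ-wLetter true  s (suc (suc (suc _)) , s≤s (s≤s ()) , _)

belowAt-φ-wLetter : ∀ {p} b s → HasPrefix (BelowAt p) (wLetter b) → HasPrefix (BelowAt (φ p)) (b ∷ s)
belowAt-φ-wLetter false s (0 , _ , a) =
  0 , z≤n , belowAt-φ [] [] ≤-by-computation ≤-by-computation a
belowAt-φ-wLetter false s (1 , _ , a) =
  0 , z≤n , belowAt-φ (false ∷ []) [] ≤-by-computation ≤-by-computation a
belowAt-φ-wLetter false s (2 , _ , a) =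
  0 , z≤n , belowAt-φ (false ∷ false ∷ []) [] ≤-by-computation ≤-by-computation a
belowAt-φ-wLetter false s (3 , _ , a) =
  0 , z≤n , belowAt-φ (false ∷ false ∷ true ∷ []) [] ≤-by-computation ≤-by-computation a
belowAt-φ-wLetter false s (suc (suc (suc (suc _))) , s≤s (s≤s (s≤s ())) , _)
belowAt-φ-wLetter true  s (0 , _ , a) =
  0 , z≤n , belowAt-φ [] [] ≤-by-computation ≤-by-computation a
belowAt-φ-wLetter true  s (1 , _ , a) =
  0 , z≤n , belowAt-φ (false ∷ []) [] ≤-by-computation ≤-by-computation a
belowAt-φ-wLetter true  s (2 , _ , a) =
  1 , s≤s z≤n , belowAt-φ (false ∷ true ∷ []) (true ∷ []) ≤-by-computation ≤-by-computation a
belowAt-φ-wLetter true  s (suc (suc (suc _)) , s≤s (s≤s ()) , _)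

module _
  (At : Point → Bitstring → Set)
  (At-++⁻ : ∀ p u v → At p (u ++ v) → At (shift u p) v)
  (At-++⁺ : ∀ p u v → At (shift u p) v → At p (u ++ v))
  (At-φ-[] : ∀ p → At p [] → At (φ p) [])
  (At-φ-wLetter : ∀ {p} b s → HasPrefix (At p) (wLetter b) → HasPrefix (At (φ p)) (b ∷ s))
  where

  hasPrefix-w : ∀ {p} S → HasPrefix (At p) (w S) → HasPrefix (At (φ p)) S
  hasPrefix-w {p} []      (zero , _ , a) = zero , z≤n , At-φ-[] p a
  hasPrefix-w {p} (b ∷ s) h with hasPrefix-++⁻ {P = At p} (wLetter b) h
  ... | inj₁ inLetter = At-φ-wLetter b s inLetter
  ... | inj₂ inRest   =
    hasPrefix-++⁺ʳ {P = At (φ p)} (b ∷ []) (hasPrefix-map (At-++⁺ (φ p) (b ∷ [])) inShiftedRest)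
    where
    inShiftedRest : HasPrefix (At (shift (b ∷ []) (φ p))) s
    inShiftedRest = subst (λ q → HasPrefix (At q) s) (φ-shift-wLetter b p)
                      (hasPrefix-w s (hasPrefix-map (At-++⁻ p (wLetter b)) inRest))

above-w : ∀ {p} S → Above p (w S) → Above (φ p) S
above-w = hasPrefix-w AboveAt aboveAt-++⁻ aboveAt-++⁺
  (λ _ → aboveAt-φ [] [] ≤-by-computation ≤-by-computation) aboveAt-φ-wLetter

below-w : ∀ {p} S → Below p (w S) → Below (φ p) S
below-w = hasPrefix-w BelowAt belowAt-++⁻ belowAt-++⁺
  (λ _ → belowAt-φ [] [] ≤-by-computation ≤-by-computation) belowAt-φ-wLetter

lemma6 : (S T : Bitstring) → Balanced S T → (x y : ℤ) →
    Between (x , y) (w S) (w T) →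
    Between (x - y - 1ℤ , (+ 2) * y - x + 1ℤ) S T
lemma6 S T _ x y (inj₁ (above , below)) = inj₁ (above-w S above , below-w T below)
lemma6 S T _ x y (inj₂ (below , above)) = inj₂ (below-w S below , above-w T above)
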